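{- Let $m\ge2$ and let $x_1,\dotsc,x_{m}$ be integers, and let $y=\gcd(\sigma_{m-1}(x_1,\dotsc,x_m),\,x_1\cdots x_m)$. If $p$ is a prime number and $V_p=\max_{i\in\{1,\dots,m-1\}}\{v_p(x_i)\}$, then (a) $v_p(y)\geq v_p(x_1\cdots x_{m-1})-V_p$, and (b) $v_p(y)\leq v_p(x_1\cdots x_{m-1})+V_p$.
   Context: $\sigma_{m-1}(x_1,\dots,x_m)=\sum_{i=1}^m\prod_{j\ne i}x_j$ is the elementary symmetric polynomial of degree $m-1$. For a prime $p$ and an integer $n$, $v_p(n)$ is the exponent of the largest power of $p$ dividing $n$. -}

module Defs where

open import Data.Nat as ℕ using (ℕ; zero; suc; _⊔_)
open import Data.Nat.Divisibility using (_∣?_; quotient)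
open import Data.Integer as ℤ using (ℤ; ∣_∣; 0ℤ; 1ℤ)
open import Data.Fin using (Fin; zero; suc; _≟_)
open import Relation.Nullary using (yes; no)

-- p-adic valuation on ℕ, computed with fuel: repeatedly divide by p.
-- Convention: value 0 when n = 0 or p ≤ 1 (never used for n = 0, p prime below).
vpFuel : ℕ → ℕ → ℕ → ℕ
vpFuel zero p n = 0
vpFuel (suc k) zero n = 0
vpFuel (suc k) (suc zero) n = 0
vpFuel (suc k) p@(suc (suc _)) zero = 0
vpFuel (suc k) p@(suc (suc _)) n@(suc _) with p ∣? n
... | yes d = suc (vpFuel k p (quotient d))
... | no _ = 0

-- v_p(n) for n : ℕ  (fuel n suffices since each step divides n by p ≥ 2)
vℕ : ℕ → ℕ → ℕ
vℕ p n = vpFuel n p n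

v : ℕ → ℤ → ℕ
v p x = vℕ p ∣ x ∣

sumF : ∀ {n} → (Fin n → ℤ) → ℤ
sumF {zero} f = 0ℤ
sumF {suc n} f = f zero ℤ.+ sumF (λ i → f (suc i))

prodF : ∀ {n} → (Fin n → ℤ) → ℤ
prodF {zero} f = 1ℤ
prodF {suc n} f = f zero ℤ.* prodF (λ i → f (suc i))

maxF : ∀ {n} → (Fin n → ℕ) → ℕ
maxF {zero} f = 0
maxF {suc n} f = f zero ⊔ maxF (λ i → f (suc i))

σ-1 : ∀ {m} → (Fin m → ℤ) → ℤ
σ-1 x = sumF (λ i → prodF (λ j → omit i j))
  where
  omit : _ → _ → ℤ
  omit i j with j ≟ i
  ... | yes _ = 1ℤ
  ... | no _ = x j

{-# OPTIONS --safe #-}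
-- Split x = (g, c) with c = x_m, P = ∏ g and S = σ_{m-2}(g); then σ_{m-1}(x) = c S + P and
-- ∏ x = P c. Each summand P / g_i of S has valuation v_p(P) − v_p(g_i) ≥ v_p(P) − V_p, so
-- p^(v_p(P) − V_p) divides S, P, and hence y: this is (a). For (b), if p^(V_p + 1) ∣ c then
-- p^(v_p(P) + 1) ∣ c S, so it cannot divide σ_{m-1}(x) = c S + P and v_p(y) ≤ v_p(P);
-- otherwise v_p(c) ≤ V_p and v_p(y) ≤ v_p(P c) = v_p(P) + v_p(c).
module Submission where

open import Defs
open import Data.Nat using (ℕ; zero; suc; 2+; _+_; _*_; _^_; _∸_; _≤_; _<_; z≤n; s≤s; NonZero; NonTrivial; nonTrivial⇒nonZero)
open import Data.Nat.Properties hiding (_≟_; suc-injective)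
open import Data.Nat.Divisibility using (_∣_; _∤_; divides; _∣?_; _∣0; 1∣_; ∣-trans; m∣m*n; *-monoʳ-∣; *-cancelˡ-∣)
open import Data.Nat.Primality using (Prime; prime⇒nonTrivial; euclidsLemma)
open import Data.Integer as ℤ using (ℤ; +_; 0ℤ; 1ℤ)
import Data.Integer.Properties as ℤ
import Data.Integer.Divisibility.Signed as ℤ
open import Data.Integer.GCD using (gcd; gcd[i,j]∣i; gcd[i,j]∣j; gcd-greatest; gcd[i,j]≡0⇒i≡0; gcd[i,j]≡0⇒j≡0)
open import Data.Fin using (Fin; zero; suc; _≟_; inject₁; fromℕ)
open import Data.Fin.Properties using (fromℕ≢inject₁; inject₁-injective; suc-injective)
open import Data.Product using (∃-syntax; _×_; _,_)
open import Data.Sum using ([_,_]′)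
open import Function using (_∘_)
open import Function.Definitions using (Injective)
open import Relation.Nullary using (¬_; yes; no; contradiction)
open import Relation.Binary.PropositionalEquality

^-monoʳ-∣ : ∀ p {m n} → m ≤ n → p ^ m ∣ p ^ n
^-monoʳ-∣ p {n = n} z≤n = 1∣ (p ^ n)
^-monoʳ-∣ p (s≤s m≤n) = *-monoʳ-∣ p (^-monoʳ-∣ p m≤n)

pow∣pow*⇒≤ : ∀ {p} .{{_ : NonZero p}} {k b w} → p ∤ w → p ^ k ∣ p ^ b * w → k ≤ b
pow∣pow*⇒≤ {k = zero} _ _ = z≤n
pow∣pow*⇒≤ {p} {suc k} {zero} {w} p∤w pᵏ⁺¹∣w =
  contradiction (∣-trans (m∣m*n (p ^ k)) (subst (p ^ suc k ∣_) (*-identityˡ w) pᵏ⁺¹∣w)) p∤w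
pow∣pow*⇒≤ {p} {suc k} {suc b} {w} p∤w pᵏ⁺¹∣pᵇ⁺¹w =
  s≤s (pow∣pow*⇒≤ p∤w (*-cancelˡ-∣ p (subst (p * p ^ k ∣_) (*-assoc p (p ^ b) w) pᵏ⁺¹∣pᵇ⁺¹w)))

private
  vpFuel-spec : ∀ p .{{_ : NonTrivial p}} k {n} → n ≢ 0 → n ≤ k →
                ∃[ u ] n ≡ p ^ vpFuel k p n * u × p ∤ u
  vpFuel-spec (2+ q) zero {zero} n≢0 _ = contradiction refl n≢0
  vpFuel-spec (2+ q) (suc k) {zero} n≢0 _ = contradiction refl n≢0
  vpFuel-spec (2+ q) (suc k) {suc n} _ n<1+k with 2+ q ∣? suc n
  ... | no p∤n = suc n , sym (*-identityˡ (suc n)) , p∤n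
  ... | yes (divides zero ())
  ... | yes (divides t@(suc _) n≡tp) =
    let t<n = subst (t <_) (sym n≡tp) (m<m*n t (2+ q) (s≤s (s≤s z≤n)))
        (u , t≡pᵃu , p∤u) = vpFuel-spec (2+ q) k {t} (λ ()) (≤-pred (≤-trans t<n n<1+k))
    in u , (begin
      suc n                        ≡⟨ n≡tp ⟩
      t * p                        ≡⟨ *-comm t p ⟩
      p * t                        ≡⟨ cong (p *_) t≡pᵃu ⟩
      p * (p ^ vpFuel k p t * u)   ≡⟨ *-assoc p (p ^ vpFuel k p t) u ⟨
      p ^ suc (vpFuel k p t) * u   ∎) , p∤u
    where
    open ≡-Reasoning
    p : ℕ
    p = 2+ q

vℕ-spec : ∀ p .{{_ : NonTrivial p}} {n} → n ≢ 0 → ∃[ u ] n ≡ p ^ vℕ p n * u × p ∤ u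
vℕ-spec p {n} n≢0 = vpFuel-spec p n n≢0 ≤-refl

pow∣-* : ∀ {p a b i j} → + (p ^ a) ℤ.∣ i → + (p ^ b) ℤ.∣ j → + (p ^ (a + b)) ℤ.∣ i ℤ.* j
pow∣-* {p} {a} {b} {i} {j} pᵃ∣i pᵇ∣j =
  subst (ℤ._∣ i ℤ.* j) (trans (sym (ℤ.pos-* (p ^ a) (p ^ b))) (cong +_ (sym (^-distribˡ-+-* p a b))))
    (ℤ.∣-trans (ℤ.*-monoʳ-∣ (+ (p ^ a)) pᵇ∣j) (ℤ.*-monoˡ-∣ j pᵃ∣i))

module _ {p : ℕ} .{{_ : NonTrivial p}} where

  private instance
    p≢0 : NonZero p
    p≢0 = nonTrivial⇒nonZero p

  pow-vℕ∣ : ∀ n → p ^ vℕ p n ∣ n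
  pow-vℕ∣ zero = _ ∣0
  pow-vℕ∣ n@(suc _) = let (u , n≡pᵃu , _) = vℕ-spec p {n} (λ ()) in
    divides u (trans n≡pᵃu (*-comm _ u))

  ≤vℕ⇒pow∣ : ∀ {k n} → k ≤ vℕ p n → p ^ k ∣ n
  ≤vℕ⇒pow∣ {n = n} k≤v = ∣-trans (^-monoʳ-∣ p k≤v) (pow-vℕ∣ n)

  pow∣⇒≤vℕ : ∀ {k n} → n ≢ 0 → p ^ k ∣ n → k ≤ vℕ p n
  pow∣⇒≤vℕ {k} n≢0 pᵏ∣n = let (u , n≡pᵃu , p∤u) = vℕ-spec p n≢0 in
    pow∣pow*⇒≤ p∤u (subst (p ^ k ∣_) n≡pᵃu pᵏ∣n)

  vℕ-unique : ∀ {n a u} → n ≢ 0 → n ≡ p ^ a * u → p ∤ u → vℕ p n ≡ a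
  vℕ-unique {n} {a} {u} n≢0 n≡pᵃu p∤u = ≤-antisym
    (pow∣pow*⇒≤ p∤u (subst (p ^ vℕ p n ∣_) n≡pᵃu (pow-vℕ∣ n)))
    (pow∣⇒≤vℕ n≢0 (subst (p ^ a ∣_) (sym n≡pᵃu) (m∣m*n u)))

  vℕ-* : Prime p → ∀ {m n} → m ≢ 0 → n ≢ 0 → vℕ p (m * n) ≡ vℕ p m + vℕ p n
  vℕ-* p-prime {m} {n} m≢0 n≢0
    with u , m≡pᵃu , p∤u ← vℕ-spec p m≢0 | w , n≡pᵇw , p∤w ← vℕ-spec p n≢0 =
    vℕ-unique mn≢0 (begin
      m * n                       ≡⟨ cong₂ _*_ m≡pᵃu n≡pᵇw ⟩
      (p ^ a * u) * (p ^ b * w)   ≡⟨ [m*n]*[o*p]≡[m*o]*[n*p] (p ^ a) u (p ^ b) w ⟩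
      (p ^ a * p ^ b) * (u * w)   ≡⟨ cong (_* (u * w)) (^-distribˡ-+-* p a b) ⟨
      p ^ (a + b) * (u * w)       ∎)
      ([ p∤u , p∤w ]′ ∘ euclidsLemma u w p-prime)
    where
    open ≡-Reasoning
    a b : ℕ
    a = vℕ p m
    b = vℕ p n
    mn≢0 : m * n ≢ 0
    mn≢0 mn≡0 = [ m≢0 , n≢0 ]′ (m*n≡0⇒m≡0∨n≡0 m mn≡0)

  ≤v⇒pow∣ : ∀ {k z} → k ≤ v p z → + (p ^ k) ℤ.∣ z
  ≤v⇒pow∣ k≤v = ℤ.∣ᵤ⇒∣ (≤vℕ⇒pow∣ k≤v)

  pow∣⇒≤v : ∀ {k z} → z ≢ 0ℤ → + (p ^ k) ℤ.∣ z → k ≤ v p z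
  pow∣⇒≤v z≢0 pᵏ∣z = pow∣⇒≤vℕ (z≢0 ∘ ℤ.∣i∣≡0⇒i≡0) (ℤ.∣⇒∣ᵤ pᵏ∣z)

  ¬pow∣⇒v≤ : ∀ {k z} → ¬ (+ (p ^ suc k) ℤ.∣ z) → v p z ≤ k
  ¬pow∣⇒v≤ pᵏ⁺¹∤z = ≮⇒≥ (pᵏ⁺¹∤z ∘ ≤v⇒pow∣)

  pow∣-weaken : ∀ {a b z} → a ≤ b → + (p ^ b) ℤ.∣ z → + (p ^ a) ℤ.∣ z
  pow∣-weaken a≤b = ℤ.∣-trans (ℤ.∣ᵤ⇒∣ (^-monoʳ-∣ p a≤b))

  ∣⇒v≤ : ∀ {i j} → i ℤ.∣ j → j ≢ 0ℤ → v p i ≤ v p j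
  ∣⇒v≤ i∣j j≢0 = pow∣⇒≤v j≢0 (ℤ.∣-trans (≤v⇒pow∣ ≤-refl) i∣j)

  v-* : Prime p → ∀ {i j} → i ≢ 0ℤ → j ≢ 0ℤ → v p (i ℤ.* j) ≡ v p i + v p j
  v-* p-prime {i} {j} i≢0 j≢0 =
    trans (cong (vℕ p) (ℤ.abs-* i j)) (vℕ-* p-prime (i≢0 ∘ ℤ.∣i∣≡0⇒i≡0) (j≢0 ∘ ℤ.∣i∣≡0⇒i≡0))

gcd∣ˡ : ∀ i j → gcd i j ℤ.∣ i
gcd∣ˡ i j = ℤ.∣ᵤ⇒∣ (gcd[i,j]∣i i j)

gcd∣ʳ : ∀ i j → gcd i j ℤ.∣ j
gcd∣ʳ i j = ℤ.∣ᵤ⇒∣ (gcd[i,j]∣j i j)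

∣gcd : ∀ {d i j} → d ℤ.∣ i → d ℤ.∣ j → d ℤ.∣ gcd i j
∣gcd {d} {i} {j} d∣i d∣j = ℤ.∣ᵤ⇒∣ (gcd-greatest {i} {j} {d} (ℤ.∣⇒∣ᵤ d∣i) (ℤ.∣⇒∣ᵤ d∣j))

sumF-cong : ∀ {n} {f g : Fin n → ℤ} → (∀ i → f i ≡ g i) → sumF f ≡ sumF g
sumF-cong {zero} f≗g = refl
sumF-cong {suc n} f≗g = cong₂ ℤ._+_ (f≗g zero) (sumF-cong (f≗g ∘ suc))

prodF-cong : ∀ {n} {f g : Fin n → ℤ} → (∀ i → f i ≡ g i) → prodF f ≡ prodF g
prodF-cong {zero} f≗g = refl
prodF-cong {suc n} f≗g = cong₂ ℤ._*_ (f≗g zero) (prodF-cong (f≗g ∘ suc))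

sumF-last : ∀ {n} (f : Fin (suc n) → ℤ) → sumF f ≡ sumF (f ∘ inject₁) ℤ.+ f (fromℕ n)
sumF-last {zero} f = ℤ.+-comm (f zero) 0ℤ
sumF-last {suc n} f =
  trans (cong (ℤ._+_ (f zero)) (sumF-last (f ∘ suc))) (sym (ℤ.+-assoc (f zero) _ _))

prodF-last : ∀ {n} (f : Fin (suc n) → ℤ) → prodF f ≡ prodF (f ∘ inject₁) ℤ.* f (fromℕ n)
prodF-last {zero} f = ℤ.*-comm (f zero) 1ℤ
prodF-last {suc n} f =
  trans (cong (ℤ._*_ (f zero)) (prodF-last (f ∘ suc))) (sym (ℤ.*-assoc (f zero) _ _))

sumF-*ˡ : ∀ {n} c (f : Fin n → ℤ) → sumF (λ i → c ℤ.* f i) ≡ c ℤ.* sumF f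
sumF-*ˡ {zero} c f = sym (ℤ.*-zeroʳ c)
sumF-*ˡ {suc n} c f =
  trans (cong (ℤ._+_ (c ℤ.* f zero)) (sumF-*ˡ c (f ∘ suc))) (sym (ℤ.*-distribˡ-+ c (f zero) _))

∣-sumF : ∀ {n d} (f : Fin n → ℤ) → (∀ i → d ℤ.∣ f i) → d ℤ.∣ sumF f
∣-sumF {zero} f d∣f = ℤ.∣ᵤ⇒∣ (_ ∣0)
∣-sumF {suc n} f d∣f = ℤ.∣m∣n⇒∣m+n (d∣f zero) (∣-sumF (f ∘ suc) (d∣f ∘ suc))

prodF≢0 : ∀ {n} (f : Fin n → ℤ) → (∀ i → f i ≢ 0ℤ) → prodF f ≢ 0ℤ
prodF≢0 {zero} f f≢0 ()
prodF≢0 {suc n} f f≢0 f₀*rest≡0 =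
  [ f≢0 zero , prodF≢0 (f ∘ suc) (f≢0 ∘ suc) ]′ (ℤ.i*j≡0⇒i≡0∨j≡0 (f zero) f₀*rest≡0)

≤maxF : ∀ {n} (f : Fin n → ℕ) i → f i ≤ maxF f
≤maxF f zero = m≤m⊔n (f zero) _
≤maxF f (suc i) = m≤n⇒m≤o⊔n (f zero) (≤maxF (f ∘ suc) i)

omit : ∀ {m} → (Fin m → ℤ) → Fin m → Fin m → ℤ
omit x i j with j ≟ i
... | yes _ = 1ℤ
... | no _ = x j

prodExcept : ∀ {m} → (Fin m → ℤ) → Fin m → ℤ
prodExcept x i = prodF (omit x i)

omit-≡ : ∀ {m} (x : Fin m → ℤ) i → omit x i i ≡ 1ℤ
omit-≡ x i with i ≟ i
... | yes _ = refl
... | no i≢i = contradiction refl i≢i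

omit-≢ : ∀ {m} (x : Fin m → ℤ) {i j} → j ≢ i → omit x i j ≡ x j
omit-≢ x {i} {j} j≢i with j ≟ i
... | yes j≡i = contradiction j≡i j≢i
... | no _ = refl

omit-∘ : ∀ {k m} (x : Fin m → ℤ) {f : Fin k → Fin m} → Injective _≡_ _≡_ f →
         ∀ i j → omit (x ∘ f) i j ≡ omit x (f i) (f j)
omit-∘ x {f} f-inj i j with j ≟ i | f j ≟ f i
... | yes _ | yes _ = refl
... | no _ | no _ = refl
... | yes j≡i | no fj≢fi = contradiction (cong f j≡i) fj≢fi
... | no j≢i | yes fj≡fi = contradiction (f-inj fj≡fi) j≢i

-- The left-hand side is the leave-one-out factor local to σ-1, which cannot be named;
-- the use in σ-1≡sumF-prodExcept determines it.
private
  omit-agrees : ∀ {m} (x : Fin m → ℤ) i j → _ ≡ omit x i j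

σ-1≡sumF-prodExcept : ∀ {m} (x : Fin m → ℤ) → σ-1 x ≡ sumF (prodExcept x)
σ-1≡sumF-prodExcept x = sumF-cong λ i → prodF-cong (omit-agrees x i)

omit-agrees x i j with j ≟ i
... | yes _ = refl
... | no _ = refl

prodExcept-* : ∀ {m} (x : Fin m → ℤ) i → prodExcept x i ℤ.* x i ≡ prodF x
prodExcept-* x zero =
  trans (cong (ℤ._* x zero) (ℤ.*-identityˡ (prodF (x ∘ suc)))) (ℤ.*-comm (prodF (x ∘ suc)) (x zero))
prodExcept-* x (suc i) = begin
  x zero ℤ.* prodF (omit x (suc i) ∘ suc) ℤ.* x (suc i)
    ≡⟨ cong (λ r → x zero ℤ.* r ℤ.* x (suc i)) (prodF-cong (sym ∘ omit-∘ x suc-injective i)) ⟩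
  x zero ℤ.* prodExcept (x ∘ suc) i ℤ.* x (suc i)
    ≡⟨ ℤ.*-assoc (x zero) _ _ ⟩
  x zero ℤ.* (prodExcept (x ∘ suc) i ℤ.* x (suc i))
    ≡⟨ cong (ℤ._*_ (x zero)) (prodExcept-* (x ∘ suc) i) ⟩
  x zero ℤ.* prodF (x ∘ suc) ∎
  where open ≡-Reasoning

prodExcept-last : ∀ {n} (x : Fin (suc n) → ℤ) → prodExcept x (fromℕ n) ≡ prodF (x ∘ inject₁)
prodExcept-last {n} x = begin
  prodF (omit x (fromℕ n))
    ≡⟨ prodF-last (omit x (fromℕ n)) ⟩
  prodF (omit x (fromℕ n) ∘ inject₁) ℤ.* omit x (fromℕ n) (fromℕ n)
    ≡⟨ cong₂ ℤ._*_ (prodF-cong λ j → omit-≢ x {fromℕ n} {inject₁ j} (fromℕ≢inject₁ ∘ sym))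
                   (omit-≡ x (fromℕ n)) ⟩
  prodF (x ∘ inject₁) ℤ.* 1ℤ
    ≡⟨ ℤ.*-identityʳ _ ⟩
  prodF (x ∘ inject₁) ∎
  where open ≡-Reasoning

prodExcept-inject₁ : ∀ {n} (x : Fin (suc n) → ℤ) i →
                     prodExcept x (inject₁ i) ≡ prodExcept (x ∘ inject₁) i ℤ.* x (fromℕ n)
prodExcept-inject₁ {n} x i = begin
  prodF (omit x (inject₁ i))
    ≡⟨ prodF-last (omit x (inject₁ i)) ⟩
  prodF (omit x (inject₁ i) ∘ inject₁) ℤ.* omit x (inject₁ i) (fromℕ n)
    ≡⟨ cong₂ ℤ._*_ (prodF-cong (sym ∘ omit-∘ x inject₁-injective i)) (omit-≢ x fromℕ≢inject₁) ⟩
  prodExcept (x ∘ inject₁) i ℤ.* x (fromℕ n) ∎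
  where open ≡-Reasoning

σ-1-last : ∀ {n} (x : Fin (suc n) → ℤ) →
           σ-1 x ≡ x (fromℕ n) ℤ.* σ-1 (x ∘ inject₁) ℤ.+ prodF (x ∘ inject₁)
σ-1-last {n} x = begin
  σ-1 x
    ≡⟨ σ-1≡sumF-prodExcept x ⟩
  sumF (prodExcept x)
    ≡⟨ sumF-last (prodExcept x) ⟩
  sumF (prodExcept x ∘ inject₁) ℤ.+ prodExcept x (fromℕ n)
    ≡⟨ cong₂ ℤ._+_ (sumF-cong λ i → trans (prodExcept-inject₁ x i) (ℤ.*-comm _ c))
                   (prodExcept-last x) ⟩
  sumF (λ i → c ℤ.* prodExcept g i) ℤ.+ prodF g
    ≡⟨ cong (ℤ._+ prodF g) (sumF-*ˡ c (prodExcept g)) ⟩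
  c ℤ.* sumF (prodExcept g) ℤ.+ prodF g
    ≡⟨ cong (λ s → c ℤ.* s ℤ.+ prodF g) (σ-1≡sumF-prodExcept g) ⟨
  c ℤ.* σ-1 g ℤ.+ prodF g ∎
  where
  open ≡-Reasoning
  c : ℤ
  c = x (fromℕ n)
  g : Fin n → ℤ
  g = x ∘ inject₁

module _ {p : ℕ} (p-prime : Prime p) where

  private instance
    p-nonTrivial : NonTrivial p
    p-nonTrivial = prime⇒nonTrivial p-prime

  v-prodExcept : ∀ {n} (g : Fin n → ℤ) → (∀ i → g i ≢ 0ℤ) →
                 ∀ i → v p (prodExcept g i) + v p (g i) ≡ v p (prodF g)
  v-prodExcept g g≢0 i =
    trans (sym (v-* p-prime prodExcept≢0 (g≢0 i))) (cong (v p) (prodExcept-* g i))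
    where
    prodExcept≢0 : prodExcept g i ≢ 0ℤ
    prodExcept≢0 prodExcept≡0 =
      prodF≢0 g g≢0 (trans (sym (prodExcept-* g i)) (cong (ℤ._* g i) prodExcept≡0))

  pow∣σ-1 : ∀ {n} (g : Fin n → ℤ) → (∀ i → g i ≢ 0ℤ) →
            + (p ^ (v p (prodF g) ∸ maxF (v p ∘ g))) ℤ.∣ σ-1 g
  pow∣σ-1 g g≢0 = subst (pᵏ ℤ.∣_) (sym (σ-1≡sumF-prodExcept g))
    (∣-sumF (prodExcept g) (≤v⇒pow∣ ∘ k≤v[prodExcept]))
    where
    k : ℕ
    k = v p (prodF g) ∸ maxF (v p ∘ g)
    pᵏ : ℤ
    pᵏ = + (p ^ k)
    k≤v[prodExcept] : ∀ i → k ≤ v p (prodExcept g i)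
    k≤v[prodExcept] i = begin
      k                                              ≤⟨ ∸-monoʳ-≤ _ (≤maxF (v p ∘ g) i) ⟩
      v p (prodF g) ∸ v p (g i)                      ≡⟨ cong (_∸ v p (g i)) (v-prodExcept g g≢0 i) ⟨
      v p (prodExcept g i) + v p (g i) ∸ v p (g i)   ≡⟨ m+n∸n≡m (v p (prodExcept g i)) (v p (g i)) ⟩
      v p (prodExcept g i)                           ∎
      where open ≤-Reasoning

  module _ {P : ℤ} (P≢0 : P ≢ 0ℤ) (c : ℤ) (V : ℕ) {S : ℤ} (pᵏ∣S : + (p ^ (v p P ∸ V)) ℤ.∣ S) where

    private
      σ X : ℤ
      σ = c ℤ.* S ℤ.+ P
      X = P ℤ.* c

      gcd≢0 : gcd σ X ≢ 0ℤ
      gcd≢0 y≡0 = [ P≢0 , c≢0 ]′ (ℤ.i*j≡0⇒i≡0∨j≡0 P (gcd[i,j]≡0⇒j≡0 {σ} y≡0))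
        where
        c≢0 : c ≢ 0ℤ
        c≢0 c≡0 = P≢0 (begin
          P               ≡⟨ ℤ.+-identityˡ P ⟨
          0ℤ ℤ.+ P        ≡⟨ cong (ℤ._+ P) (ℤ.*-zeroˡ S) ⟨
          0ℤ ℤ.* S ℤ.+ P  ≡⟨ cong (λ c′ → c′ ℤ.* S ℤ.+ P) c≡0 ⟨
          σ               ≡⟨ gcd[i,j]≡0⇒i≡0 σ X y≡0 ⟩
          0ℤ              ∎)
          where open ≡-Reasoning

    ≤v-gcd : v p P ∸ V ≤ v p (gcd (c ℤ.* S ℤ.+ P) (P ℤ.* c))
    ≤v-gcd = pow∣⇒≤v gcd≢0 (∣gcd pᵏ∣σ pᵏ∣X)
      where
      pᵏ∣P : + (p ^ (v p P ∸ V)) ℤ.∣ P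
      pᵏ∣P = ≤v⇒pow∣ (m∸n≤m (v p P) V)
      pᵏ∣σ : + (p ^ (v p P ∸ V)) ℤ.∣ σ
      pᵏ∣σ = ℤ.∣m∣n⇒∣m+n (ℤ.∣n⇒∣m*n c pᵏ∣S) pᵏ∣P
      pᵏ∣X : + (p ^ (v p P ∸ V)) ℤ.∣ X
      pᵏ∣X = ℤ.∣m⇒∣m*n c pᵏ∣P

    v-gcd≤ : v p (gcd (c ℤ.* S ℤ.+ P) (P ℤ.* c)) ≤ v p P + V
    v-gcd≤ with + (p ^ suc V) ℤ.∣? c
    ... | yes pⱽ⁺¹∣c = ≤-trans (¬pow∣⇒v≤ pᵛᴾ⁺¹∤y) (m≤m+n (v p P) V)
      where
      pᵛᴾ⁺¹∣cS : + (p ^ suc (v p P)) ℤ.∣ c ℤ.* S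
      pᵛᴾ⁺¹∣cS = pow∣-weaken (s≤s (m≤n+m∸n (v p P) V)) (pow∣-* {p} {suc V} pⱽ⁺¹∣c pᵏ∣S)
      pᵛᴾ⁺¹∤y : ¬ (+ (p ^ suc (v p P)) ℤ.∣ gcd σ X)
      pᵛᴾ⁺¹∤y pᵛᴾ⁺¹∣y = n≮n (v p P) (pow∣⇒≤v P≢0
        (ℤ.∣m+n∣m⇒∣n (ℤ.∣-trans pᵛᴾ⁺¹∣y (gcd∣ˡ σ X)) pᵛᴾ⁺¹∣cS))
    ... | no pⱽ⁺¹∤c = begin
      v p (gcd σ X)   ≤⟨ ∣⇒v≤ (gcd∣ʳ σ X) X≢0 ⟩
      v p X           ≡⟨ v-* p-prime P≢0 c≢0 ⟩
      v p P + v p c   ≤⟨ +-monoʳ-≤ (v p P) (¬pow∣⇒v≤ pⱽ⁺¹∤c) ⟩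
      v p P + V       ∎
      where
      open ≤-Reasoning
      c≢0 : c ≢ 0ℤ
      c≢0 c≡0 = pⱽ⁺¹∤c (subst (+ (p ^ suc V) ℤ.∣_) (sym c≡0) (ℤ.∣ᵤ⇒∣ (_ ∣0)))
      X≢0 : X ≢ 0ℤ
      X≢0 X≡0 = [ P≢0 , c≢0 ]′ (ℤ.i*j≡0⇒i≡0∨j≡0 P X≡0)

theorem4p3 : (n : ℕ) → 1 ≤ n → (x : Fin (suc n) → ℤ) →
    ((i : Fin n) → x (inject₁ i) ≢ 0ℤ) →
    (p : ℕ) → Prime p →
    let y = gcd (σ-1 x) (prodF x)
        P = prodF (λ i → x (inject₁ i))
        Vp = maxF (λ i → v p (x (inject₁ i)))
    in (v p P ∸ Vp ≤ v p y) × (v p y ≤ v p P + Vp)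
theorem4p3 n _ x g≢0 p p-prime rewrite σ-1-last x | prodF-last x =
  ≤v-gcd p-prime P≢0 c V pᵏ∣S , v-gcd≤ p-prime P≢0 c V pᵏ∣S
  where
  g : Fin n → ℤ
  g = x ∘ inject₁
  c : ℤ
  c = x (fromℕ n)
  V : ℕ
  V = maxF (v p ∘ g)
  P≢0 : prodF g ≢ 0ℤ
  P≢0 = prodF≢0 g g≢0
  pᵏ∣S : + (p ^ (v p (prodF g) ∸ V)) ℤ.∣ σ-1 g
  pᵏ∣S = pow∣σ-1 p-prime g g≢0
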